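{- Let $P$ be a non-empty finite set of prime numbers and let $p$ be its largest element. Let $a>0$ and $k>1$ be integers. Then there exists a positive integer $a'$ such that $\max_{i\in P} s_i(a')=s_p(a')$ and the base-$k$ digit string $[a]_k$ is a prefix of $[a']_k$ (i.e. $a'=a\cdot k^e+f$ for some integers $e\ge 0$ and $0\le f<k^e$).
   Context: $s_q(n)$ denotes the sum of the digits of $n$ in base $q$; $[n]_k$ denotes the string of base-$k$ digits of $n$ written from the most significant digit. -}

module Defs where

open import Data.Nat using (ℕ; zero; suc; _≤_; _<_; _/_; _%_; _⊔_; NonZero)
open import Data.Nat.DivMod using (m/n<m)
open import Data.Nat.Induction using (<-rec)
open import Data.List using (List; []; _∷_)

-- s_q(n): sum of the digits of n in base q (for q ≥ 2; for q < 2 we set it to 0,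
-- a junk value never used since the statement only applies it to primes).
digitSumAux : (q : ℕ) → .{{NonZero q}} → 2 ≤ q → (n : ℕ) → ({m : ℕ} → m < n → ℕ) → ℕ
digitSumAux q q≥2 zero rec = 0
digitSumAux q q≥2 (suc n) rec = (suc n % q) Data.Nat.+ rec {suc n / q} (m/n<m (suc n) q q≥2)

digitSum : ℕ → ℕ → ℕ
digitSum zero n = 0
digitSum (suc zero) n = 0
digitSum q@(suc (suc _)) n = <-rec (λ _ → ℕ) (digitSumAux q (Data.Nat.s≤s (Data.Nat.s≤s Data.Nat.z≤n))) n

maxOver : (ℕ → ℕ) → List ℕ → ℕ
maxOver f [] = 0
maxOver f (x ∷ xs) = f x ⊔ maxOver f xs

module Submission where

-- Write p = r + 2, C = (a + 1)k, m = (p - 1)!·C·p^p and M = p^m.  Pick e with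
-- M ≤ k^e < kM and let a' = a·k^e + f with the unique f < M making a' + 1 ≡ 0 (mod M).
--   * The last m base-p digits of a' are p - 1, so s_p(a') ≥ (p - 1)m.
--   * a' < C·M.  For 2 ≤ q < p write m = (q - 1)j; then j ≥ C·p^(q-1), and the
--     inequality p^(q-1) < q^(p-1) together with Bernoulli's inequality yields
--     a' < C·(p^(q-1))^j < q^((p-1)j), hence s_q(a') ≤ (q - 1)(p - 1)j = (p - 1)m.

open import Defs
open import Data.Nat using (ℕ; _≤_; _<_; _>_; _+_; _*_; _^_)
open import Data.Nat.Primality using (Prime)
open import Data.List using (List; [])
open import Data.List.Membership.Propositional using (_∈_)
open import Data.List.Relation.Unary.All using (All)
open import Data.Product using (∃; _×_; Σ-syntax; ∃-syntax)
open import Relation.Binary.PropositionalEquality using (_≡_)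

open import Data.Nat.Base using (zero; suc; pred; _∸_; _%_; _/_; _⊔_; _!; z≤n; s≤s; z<s; NonZero; >-nonZero; nonTrivial⇒n>1; _≤′_; ≤′-refl; ≤′-step)
open import Data.Nat.Properties
open import Data.Nat.DivMod
open import Data.Nat.Divisibility using (divides; ∣-trans; m∣m*n; m≤n⇒m!∣n!)
open import Data.Nat.Induction using (<-wellFounded)
open import Data.Nat.Tactic.RingSolver using (solve-∀)
open import Data.Nat.Primality using (prime⇒nonTrivial; ¬prime[0]; ¬prime[1])
open import Data.List using (_∷_)
open import Data.List.Relation.Unary.All using ([]; _∷_; lookup; zipWith)
open import Data.List.Relation.Unary.Any using (here; there)
open import Data.Product using (_,_; proj₁; proj₂)
open import Data.Sum using (inj₁; inj₂)
open import Relation.Binary.PropositionalEquality using (refl; sym; trans; cong; cong₂; subst; module ≡-Reasoning)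
open import Relation.Nullary using (yes; no; contradiction)
import Induction.WellFounded as WF

module DigitSums (r : ℕ) where

  private
    q : ℕ
    q = 2 + r

    step : (n : ℕ) → ({m : ℕ} → m < n → ℕ) → ℕ
    step = digitSumAux q (s≤s (s≤s z≤n))

    -- The recursion step depends only on the values of its recursive calls; this
    -- extensionality is what lets the well-founded recursion be unfolded.
    step-ext : (n : ℕ) {IH IH′ : WF.WfRec _<_ (λ _ → ℕ) n} →
               (∀ {m} m<n → IH {m} m<n ≡ IH′ m<n) → step n IH ≡ step n IH′
    step-ext zero    _  = refl
    step-ext (suc n) eq = cong (suc n % q +_) (eq _)

    open WF.FixPoint <-wellFounded (λ _ → ℕ) step step-ext using (unfold-wfRec)

  digitSum-unfold : ∀ n → digitSum q n ≡ n % q + digitSum q (n / q)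
  digitSum-unfold zero    = refl
  digitSum-unfold (suc n) = unfold-wfRec {suc n}

  digitSum-append : ∀ d t → d < q → digitSum q (d + t * q) ≡ d + digitSum q t
  digitSum-append d t d<q = begin
    digitSum q (d + t * q)                         ≡⟨ digitSum-unfold (d + t * q) ⟩
    (d + t * q) % q + digitSum q ((d + t * q) / q) ≡⟨ cong₂ (λ x y → x + digitSum q y) last-digit rest ⟩
    d + digitSum q t                               ∎
    where
    open ≡-Reasoning
    last-digit : (d + t * q) % q ≡ d
    last-digit = trans ([m+kn]%n≡m%n d t q) (m<n⇒m%n≡m d<q)
    rest : (d + t * q) / q ≡ t
    rest = trans (+-distrib-/-∣ʳ d (divides t refl)) (cong₂ _+_ (m<n⇒m/n≡0 d<q) (m*n/n≡m t q))

  digitSum-≤ : ∀ D n → n < q ^ D → digitSum q n ≤ suc r * D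
  digitSum-≤ zero    zero    _ = z≤n
  digitSum-≤ zero    (suc n) (s≤s ())
  digitSum-≤ (suc D) n n<q^1+D = begin
    digitSum q n               ≡⟨ digitSum-unfold n ⟩
    n % q + digitSum q (n / q) ≤⟨ +-mono-≤ (m<1+n⇒m≤n (m%n<n n q)) (digitSum-≤ D (n / q) (m<n*o⇒m/o<n n<q^D*q)) ⟩
    suc r + suc r * D          ≡⟨ *-suc (suc r) D ⟨
    suc r * suc D              ∎
    where
    open ≤-Reasoning
    n<q^D*q : n < q ^ D * q
    n<q^D*q = subst (n <_) (*-comm q (q ^ D)) n<q^1+D

  -- If q^m divides n + 1, the last m digits of n all equal q - 1, so s_q(n) ≥ (q - 1)·m.
  digitSum-≥ : ∀ m c n → suc n ≡ q ^ m * suc c → suc r * m ≤ digitSum q n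
  digitSum-≥ zero    c n _  = ≤-trans (≤-reflexive (*-zeroʳ (suc r))) z≤n
  digitSum-≥ (suc m) c n eq = begin
    suc r * suc m              ≡⟨ *-suc (suc r) m ⟩
    suc r + suc r * m          ≤⟨ +-monoʳ-≤ (suc r) (digitSum-≥ m c t (suc-pred (q ^ m * suc c))) ⟩
    suc r + digitSum q t       ≡⟨ digitSum-append (suc r) t ≤-refl ⟨
    digitSum q (suc r + t * q) ≡⟨ cong (digitSum q) n≡ ⟨
    digitSum q n               ∎
    where
    open ≤-Reasoning
    instance
      q^m*[1+c]≢0 : NonZero (q ^ m * suc c)
      q^m*[1+c]≢0 = m*n≢0 (q ^ m) (suc c) {{m^n≢0 q m}}
    t : ℕ
    t = pred (q ^ m * suc c)
    n≡ : n ≡ suc r + t * q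
    n≡ = suc-injective (begin-equality
      suc n           ≡⟨ trans eq (*-assoc q (q ^ m) (suc c)) ⟩
      q * (q ^ m * suc c) ≡⟨ cong (q *_) (suc-pred (q ^ m * suc c)) ⟨
      q * suc t       ≡⟨ *-suc q t ⟩
      q + q * t       ≡⟨ cong (q +_) (*-comm q t) ⟩
      q + t * q       ∎)

-- Bernoulli's inequality in the form (1 + 1/B)^j ≥ 1 + j/B, cleared of denominators.
bernoulli : ∀ B j → B ^ j * (B + j) ≤ B * suc B ^ j
bernoulli B zero    = ≤-reflexive (e₀ B)
  where
  e₀ : ∀ B → 1 * (B + 0) ≡ B * 1
  e₀ = solve-∀
bernoulli B (suc j) = begin
  (B * B ^ j) * (B + suc j)   ≡⟨ e₁ B (B ^ j) j ⟩
  B ^ j * (B * (B + suc j))   ≤⟨ *-monoʳ-≤ (B ^ j) (subst (B * (B + suc j) ≤_) (sym (e₂ B j)) (m≤m+n _ j)) ⟩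
  B ^ j * ((B + j) * suc B)   ≡⟨ *-assoc (B ^ j) (B + j) (suc B) ⟨
  (B ^ j * (B + j)) * suc B   ≤⟨ *-monoˡ-≤ (suc B) (bernoulli B j) ⟩
  (B * suc B ^ j) * suc B     ≡⟨ e₃ B (suc B ^ j) ⟩
  B * (suc B * suc B ^ j)     ∎
  where
  open ≤-Reasoning
  e₁ : ∀ B X j → (B * X) * (B + suc j) ≡ X * (B * (B + suc j))
  e₁ = solve-∀
  e₂ : ∀ B j → (B + j) * suc B ≡ B * (B + suc j) + j
  e₂ = solve-∀
  e₃ : ∀ B X → (B * X) * suc B ≡ B * (suc B * X)
  e₃ = solve-∀

-- If A ≥ B + 1 and the exponent j is at least C·B, then A^j outgrows C·B^j:
-- by Bernoulli, (A/B)^j ≥ 1 + j/B ≥ 1 + C.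
power-gap : ∀ A B C j → suc B ≤ A → C * B ≤ j → 0 < B → C * B ^ j < A ^ j
power-gap A B C j B<A CB≤j B>0 = *-cancelˡ-< B _ _ (begin-strict
  B * (C * B ^ j)             <⟨ m<m+n (B * (C * B ^ j)) (*-mono-< (m^n>0 B {{>-nonZero B>0}} j) B>0) ⟩
  B * (C * B ^ j) + B ^ j * B ≡⟨ e (B ^ j) B C ⟩
  B ^ j * (B + C * B)         ≤⟨ *-monoʳ-≤ (B ^ j) (+-monoʳ-≤ B CB≤j) ⟩
  B ^ j * (B + j)             ≤⟨ bernoulli B j ⟩
  B * suc B ^ j               ≤⟨ *-monoʳ-≤ B (^-monoˡ-≤ j B<A) ⟩
  B * A ^ j                   ∎)
  where
  open ≤-Reasoning
  e : ∀ X B C → B * (C * X) + X * B ≡ X * (B + C * B)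
  e = solve-∀

-- A reverse Bernoulli inequality: (1 + 1/p)^n ≤ p/(p - n) for n < p, cleared of denominators.
bernoulli-reverse : ∀ n s p → p ≡ n + suc s → suc p ^ n * suc s ≤ p ^ suc n
bernoulli-reverse zero    s p refl = ≤-reflexive (e₀ s)
  where
  e₀ : ∀ s → 1 * suc s ≡ suc s * 1
  e₀ = solve-∀
bernoulli-reverse (suc n) s p p≡ = begin
  (suc p * suc p ^ n) * suc s   ≡⟨ e₁ (suc p) (suc p ^ n) (suc s) ⟩
  suc p ^ n * (suc p * suc s)   ≤⟨ *-monoʳ-≤ (suc p ^ n) one-factor ⟩
  suc p ^ n * (p * suc (suc s)) ≡⟨ e₂ (suc p ^ n) p (suc (suc s)) ⟩
  p * (suc p ^ n * suc (suc s)) ≤⟨ *-monoʳ-≤ p (bernoulli-reverse n (suc s) p (trans p≡ (sym (+-suc n (suc s))))) ⟩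
  p * p ^ suc n                 ∎
  where
  open ≤-Reasoning
  e₁ : ∀ a b c → (a * b) * c ≡ b * (a * c)
  e₁ = solve-∀
  e₂ : ∀ a b c → a * (b * c) ≡ b * (a * c)
  e₂ = solve-∀
  e₃ : ∀ p s → suc p * suc s ≡ suc s + p * suc s
  e₃ = solve-∀
  s<p : suc s ≤ p
  s<p = subst (suc s ≤_) (sym p≡) (≤-trans (n≤1+n (suc s)) (s≤s (m≤n+m (suc s) n)))
  one-factor : suc p * suc s ≤ p * suc (suc s)
  one-factor = begin
    suc p * suc s     ≡⟨ e₃ p s ⟩
    suc s + p * suc s ≤⟨ +-monoˡ-≤ (p * suc s) s<p ⟩
    p + p * suc s     ≡⟨ *-suc p (suc s) ⟨
    p * suc (suc s)   ∎

-- (x + 1)^(x - 1) < x^x for x = n + 2, i.e. (1 + 1/x)^(x-1) < x: the reverse Bernoulli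
-- bound gives (1 + 1/x)^(x-2) ≤ x/2, and 1 + 1/x < 2.
consecutive-powers : ∀ n → (3 + n) ^ (1 + n) < (2 + n) ^ (2 + n)
consecutive-powers n = begin-strict
  suc x * X   <⟨ *-monoˡ-< X {{m^n≢0 (suc x) n}} 1+x<2x ⟩
  (x * 2) * X ≡⟨ e x X ⟩
  x * (X * 2) ≤⟨ *-monoʳ-≤ x (bernoulli-reverse n 1 x (+-comm 2 n)) ⟩
  x * x ^ suc n ∎
  where
  open ≤-Reasoning
  x X : ℕ
  x = 2 + n
  X = suc x ^ n
  e : ∀ a b → (a * 2) * b ≡ a * (b * 2)
  e = solve-∀
  1+x<2x : suc x < x * 2
  1+x<2x = subst (suc x <_) (trans (cong (x +_) (sym (+-identityʳ x))) (*-comm 2 x))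
                 (+-monoˡ-< x (s≤s (s≤s z≤n)))

^-cancelʳ-< : ∀ x y N → x ^ N < y ^ N → x < y
^-cancelʳ-< x y N x^N<y^N with x <? y
... | yes x<y = x<y
... | no  x≮y = contradiction (^-monoˡ-≤ N (≮⇒≥ x≮y)) (<⇒≱ x^N<y^N)

-- Transitivity of bounds on ratios of logarithms: log a/log b < y/x and log b/log c < x/z
-- give log a/log c < y/z.
power-ratio-trans : ∀ a b c x y z .{{_ : NonZero y}} .{{_ : NonZero z}} →
                    a ^ x < b ^ y → b ^ z < c ^ x → a ^ z < c ^ y
power-ratio-trans a b c x y z a^x<b^y b^z<c^x = ^-cancelʳ-< (a ^ z) (c ^ y) x (begin-strict
  (a ^ z) ^ x ≡⟨ swap a z x ⟩
  (a ^ x) ^ z <⟨ ^-monoˡ-< z a^x<b^y ⟩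
  (b ^ y) ^ z ≡⟨ swap b y z ⟩
  (b ^ z) ^ y <⟨ ^-monoˡ-< y b^z<c^x ⟩
  (c ^ x) ^ y ≡⟨ swap c x y ⟩
  (c ^ y) ^ x ∎)
  where
  open ≤-Reasoning
  swap : ∀ w m n → (w ^ m) ^ n ≡ (w ^ n) ^ m
  swap w m n = trans (^-*-assoc w m n) (trans (cong (w ^_) (*-comm m n)) (sym (^-*-assoc w n m)))

-- p^(q-1) < q^(p-1) for 2 ≤ q < p (here q = 2 + u and p = 2 + v): the function
-- x ↦ x^(1/(x-1)) is strictly decreasing, proved by chaining consecutive steps.
power-swap : ∀ u v → u < v → (2 + v) ^ (1 + u) < (2 + u) ^ (1 + v)
power-swap u v u<v = go (≤⇒≤′ u<v)
  where
  go : ∀ {v} → suc u ≤′ v → (2 + v) ^ (1 + u) < (2 + u) ^ (1 + v)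
  go ≤′-refl           = consecutive-powers u
  go (≤′-step {v} u<v) = power-ratio-trans (3 + v) (2 + v) (2 + u) (1 + v) (2 + v) (1 + u)
                           (consecutive-powers v) (go u<v)

power-bracket : ∀ k → 1 < k → ∀ x → 0 < x → ∃[ e ] (x ≤ k ^ e × k ^ e < k * x)
power-bracket k k>1 x x>0 = search x (x≤k^x x)
  where
  instance
    k≢0 : NonZero k
    k≢0 = >-nonZero (<-trans z<s k>1)
    x≢0 : NonZero x
    x≢0 = >-nonZero x>0
  x≤k^x : ∀ n → n ≤ k ^ n
  x≤k^x zero    = z≤n
  x≤k^x (suc n) = ≤-<-trans (x≤k^x n) (^-monoʳ-< k k>1 (n<1+n n))
  -- descend from an exponent n with x ≤ k^n to the least such exponent
  search : ∀ n → x ≤ k ^ n → ∃[ e ] (x ≤ k ^ e × k ^ e < k * x)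
  search zero    x≤1 = 0 , x≤1 , <-≤-trans k>1 (m≤m*n k x)
  search (suc n) x≤k^1+n with x ≤? k ^ n
  ... | yes x≤k^n = search n x≤k^n
  ... | no  x≰k^n = suc n , x≤k^1+n , *-monoʳ-< k (≰⇒> x≰k^n)

-- Every 1 ≤ x ≤ n divides n!, so n!·J = x·j for a multiple j ≥ J of J.
factorial-split : ∀ n x J → 0 < x → x ≤ n → ∃[ j ] (n ! * J ≡ x * j × J ≤ j)
factorial-split n (suc x) J _ x≤n with ∣-trans (m∣m*n {suc x} (x !)) (m≤n⇒m!∣n! x≤n)
... | divides zero    n!≡0 = contradiction (subst (1 ≤_) n!≡0 (1≤n! n)) λ ()
... | divides (suc R) n!≡  = suc R * J , n!J≡ , m≤n*m J (suc R)
  where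
  e : ∀ R x J → (R * x) * J ≡ x * (R * J)
  e = solve-∀
  n!J≡ : n ! * J ≡ suc x * (suc R * J)
  n!J≡ = trans (cong (_* J) n!≡) (e (suc R) (suc x) J)

maxOver-lub : ∀ (g : ℕ → ℕ) b P → All (λ q → g q ≤ b) P → maxOver g P ≤ b
maxOver-lub g b []       []         = z≤n
maxOver-lub g b (q ∷ qs) (gq≤b ∷ h) = ⊔-lub gq≤b (maxOver-lub g b qs h)

maxOver-attained : ∀ (g : ℕ → ℕ) p P → p ∈ P → All (λ q → g q ≤ g p) P → maxOver g P ≡ g p
maxOver-attained g p (q ∷ qs) (here refl) (_    ∷ h) = m≥n⇒m⊔n≡m (maxOver-lub g (g q) qs h)
maxOver-attained g p (q ∷ qs) (there p∈qs) (gq≤gp ∷ h) =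
  trans (cong (g q ⊔_) (maxOver-attained g p qs p∈qs h)) (m≤n⇒m⊔n≡n gq≤gp)

module Construction (r a k : ℕ) (a>0 : a > 0) (k>1 : k > 1) where

  p C J m M : ℕ
  p = 2 + r
  C = suc a * k        -- a' < C·M
  J = C * p ^ p        -- exponent slack required by power-gap
  m = suc r ! * J      -- divisible by q - 1 for every 2 ≤ q ≤ p
  M = p ^ m            -- a' + 1 will be a multiple of M

  instance
    M≢0 : NonZero M
    M≢0 = m^n≢0 p m

  private
    bracket : ∃[ e ] (M ≤ k ^ e × k ^ e < k * M)
    bracket = power-bracket k k>1 M (m^n>0 p m)

  -- Append e base-k digits to a, e chosen with M ≤ k^e < k·M ...
  e : ℕ
  e = proj₁ bracket

  -- ... and fill them with the f < M that makes a' + 1 a multiple of M.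
  t f a' : ℕ
  t  = a * k ^ e
  f  = M ∸ suc (t % M)
  a' = t + f

  f<k^e : f < k ^ e
  f<k^e = <-≤-trans (∸-monoʳ-< z<s (m%n<n t M)) (proj₁ (proj₂ bracket))

  a'+1≡M*[1+c] : suc a' ≡ M * suc (t / M)
  a'+1≡M*[1+c] = begin
    suc (t + f)                 ≡⟨ cong (λ z → suc (z + f)) (m≡m%n+[m/n]*n t M) ⟩
    suc (t % M + c * M + f)     ≡⟨ e₁ (t % M) (c * M) f ⟩
    c * M + (suc (t % M) + f)   ≡⟨ cong (c * M +_) (m+[n∸m]≡n (m%n<n t M)) ⟩
    c * M + M                   ≡⟨ e₂ c M ⟩
    M * suc c                   ∎
    where
    open ≡-Reasoning
    c : ℕ
    c = t / M
    e₁ : ∀ x y z → suc (x + y + z) ≡ y + (suc x + z)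
    e₁ = solve-∀
    e₂ : ∀ c M → c * M + M ≡ M * suc c
    e₂ = solve-∀

  a'<C*M : a' < C * M
  a'<C*M = begin-strict
    t + f               <⟨ +-monoʳ-< t f<k^e ⟩
    a * k ^ e + k ^ e   ≡⟨ +-comm (a * k ^ e) (k ^ e) ⟩
    suc a * k ^ e       ≤⟨ *-monoʳ-≤ (suc a) (<⇒≤ (proj₂ (proj₂ bracket))) ⟩
    suc a * (k * M)     ≡⟨ *-assoc (suc a) k M ⟨
    C * M               ∎
    where open ≤-Reasoning

  a'>0 : a' > 0
  a'>0 = ≤-trans (*-mono-≤ a>0 (m^n>0 k {{>-nonZero (<-trans z<s k>1)}} e)) (m≤m+n t f)

  -- The last m base-p digits of a' are p - 1.
  digitSum-p : suc r * m ≤ digitSum p a'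
  digitSum-p = DigitSums.digitSum-≥ r m (t / M) a' a'+1≡M*[1+c]

  -- For q = 2 + u < p, a' has at most (p-1)m/(q-1) base-q digits: with m = (q-1)·j,
  -- a' < C·(p^(q-1))^j < (q^(p-1))^j by power-swap and power-gap.
  digitSum-smaller-base : ∀ u → u < r → digitSum (2 + u) a' ≤ digitSum p a'
  digitSum-smaller-base u u<r = begin
    digitSum q a'         ≤⟨ DigitSums.digitSum-≤ u (suc r * j) a' a'<q^D ⟩
    suc u * (suc r * j)   ≡⟨ e₁ (suc u) (suc r) j ⟩
    suc r * (suc u * j)   ≡⟨ cong (suc r *_) m≡ ⟨
    suc r * m             ≤⟨ digitSum-p ⟩
    digitSum p a'         ∎
    where
    open ≤-Reasoning
    q : ℕ
    q = 2 + u
    e₁ : ∀ x y z → x * (y * z) ≡ y * (x * z)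
    e₁ = solve-∀
    split : ∃[ j ] (m ≡ suc u * j × J ≤ j)
    split = factorial-split (suc r) (suc u) J z<s (s≤s (<⇒≤ u<r))
    j : ℕ
    j = proj₁ split
    m≡ : m ≡ suc u * j
    m≡ = proj₁ (proj₂ split)
    CB≤j : C * p ^ suc u ≤ j
    CB≤j = ≤-trans (*-monoʳ-≤ C (^-monoʳ-≤ p (s≤s (≤-trans (<⇒≤ u<r) (n≤1+n r)))))
                   (proj₂ (proj₂ split))
    a'<q^D : a' < q ^ (suc r * j)
    a'<q^D = begin-strict
      a'                    <⟨ a'<C*M ⟩
      C * p ^ m             ≡⟨ cong (λ z → C * p ^ z) m≡ ⟩
      C * p ^ (suc u * j)   ≡⟨ cong (C *_) (^-*-assoc p (suc u) j) ⟨
      C * (p ^ suc u) ^ j   <⟨ power-gap (q ^ suc r) (p ^ suc u) C j (power-swap u r u<r) CB≤j (m^n>0 p (suc u)) ⟩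
      (q ^ suc r) ^ j       ≡⟨ ^-*-assoc q (suc r) j ⟩
      q ^ (suc r * j)       ∎

  digitSum-dominated : ∀ q → 1 < q → q ≤ p → digitSum q a' ≤ digitSum p a'
  digitSum-dominated (suc zero)    (s≤s ()) _
  digitSum-dominated (suc (suc u)) _ q≤p with m≤n⇒m<n∨m≡n q≤p
  ... | inj₁ q<p  = digitSum-smaller-base u (≤-pred (≤-pred q<p))
  ... | inj₂ refl = ≤-refl

lemma3p4 : (P : List ℕ) → All Prime P → (p : ℕ) → p ∈ P → All (λ q → q ≤ p) P →
    (a k : ℕ) → a > 0 → k > 1 →
    ∃[ a' ] (a' > 0 × maxOver (λ i → digitSum i a') P ≡ digitSum p a' ×
    ∃[ e ] ∃[ f ] (f < k ^ e × a' ≡ a * k ^ e + f))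
lemma3p4 P primes zero          p∈P _     _ _ _   _   = contradiction (lookup primes p∈P) ¬prime[0]
lemma3p4 P primes (suc zero)    p∈P _     _ _ _   _   = contradiction (lookup primes p∈P) ¬prime[1]
lemma3p4 P primes (suc (suc r)) p∈P p-max a k a>0 k>1 =
  a' , a'>0 , maxOver-attained (λ i → digitSum i a') p P p∈P dominated , e , f , f<k^e , refl
  where
  open Construction r a k a>0 k>1
  dominated : All (λ q → digitSum q a' ≤ digitSum p a') P
  dominated = zipWith (λ { {q} (q-prime , q≤p) →
                digitSum-dominated q (nonTrivial⇒n>1 q {{prime⇒nonTrivial q-prime}}) q≤p })
              (primes , p-max)
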